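{- Let $n$ be a natural number. (a) If $n$ is even, then $n$ can be written as a sum of two Zumkeller numbers if and only if $n \geq 12$ and $n \notin \{14, 16, 20, 22, 28, 38\}$. (b) If $n$ is an odd number greater than $94185$, then $n$ can be written as a sum of two Zumkeller numbers.
   Context: A natural number (positive integer) $n$ is a Zumkeller number if the set of its positive divisors can be partitioned into two subsets with equal sums; equivalently, $\sigma(n)/2$ is a sum of distinct positive divisors of $n$, where $\sigma(n)$ is the sum of the positive divisors of $n$. "A sum of two Zumkeller numbers" means $n = z_1 + z_2$ with $z_1, z_2$ Zumkeller numbers (not necessarily distinct). -}

module Defs where

open import Data.Nat using (ℕ; suc; _+_; _≥_)
open import Data.Nat.Divisibility using (_∣?_)
open import Data.List using (List; filter; applyUpTo)
open import Data.Nat.ListAction using (sum)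
open import Data.List.Relation.Binary.Sublist.Propositional using (_⊆_)
open import Data.Product using (∃; ∃₂; _×_)
open import Relation.Binary.PropositionalEquality using (_≡_)

divisors : ℕ → List ℕ
divisors n = filter (_∣? n) (applyUpTo suc n)

σ : ℕ → ℕ
σ n = sum (divisors n)

-- n is Zumkeller: n is positive and σ(n)/2 is a sum of distinct divisors of n,
-- i.e. some sub-list S of the (duplicate-free) divisor list satisfies 2·ΣS = σ(n).
-- (Equivalently, the divisors split into S and its complement with equal sums.)
Zumkeller : ℕ → Set
Zumkeller n = n ≥ 1 × ∃ λ (S : List ℕ) → S ⊆ divisors n × sum S + sum S ≡ σ n

SumOfTwoZumkeller : ℕ → Set
SumOfTwoZumkeller n = ∃₂ λ z₁ z₂ → Zumkeller z₁ × Zumkeller z₂ × z₁ + z₂ ≡ n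

{-# OPTIONS --safe #-}
-- If a is Zumkeller and gcd (a, b) = 1 then a * b is Zumkeller: σ is multiplicative, and a set S
-- of divisors of a summing to σ(a)/2 lifts to the set S × divisors(b), summing to σ(a * b)/2.
-- Since 2^(3+j) * 11 is Zumkeller, so is 88 w for every w with 11 ∤ w. Hence if m = a + 88 c with
-- a Zumkeller and 11 ∤ c, then every m + 968 q = a + 88 (c + 11 q) is a sum of two Zumkeller
-- numbers, and it suffices to find such a splitting for one window of 968 consecutive numbers of
-- each parity, with a taken from numbers certified Zumkeller by explicit half-sum sets and from
-- their coprime multiples. Even numbers below the window are sums of two certified numbers, and
-- an exhaustive search shows that 6, 12, 20, 24, 28, 30 are the only Zumkeller numbers below 39,
-- which rules out n < 12 and the six exceptions.
module Submission where

open import Defs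
open import Data.Nat
open import Data.Nat.Properties
open import Data.Nat.Divisibility
open import Data.Nat.GCD using (gcd; gcd[m,n]∣m; gcd[m,n]∣n)
open import Data.Nat.DivMod using (m*[n/m]≡n; m/n*n≡m; m*n/n≡m; m≡m%n+[m/n]*n; m%n<n)
open import Data.Nat.Coprimality using (Coprime; coprime-divisor; coprime-/gcd; coprime?)
open import Data.Nat.Primality using (Prime; prime?; prime[2]; prime⇒irreducible)
open import Data.Nat.Induction using (<-wellFounded)
open import Data.Nat.ListAction using (sum)
open import Data.Nat.ListAction.Properties using (sum-↭; sum-++)
open import Data.Nat.Solver using (module +-*-Solver)
open import Data.List using (List; []; _∷_; _++_; map; filter; applyUpTo; upTo; concatMap; cartesianProductWith)
open import Data.List.Membership.Propositional using (_∈_; _∉_; find; lose)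
open import Data.List.Membership.Propositional.Properties
open import Data.List.Membership.Propositional.Properties.WithK using (unique∧set⇒bag)
open import Data.List.Membership.DecPropositional _≟_ using (_∈?_)
open import Data.List.Relation.Binary.BagAndSetEquality using (∼bag⇒↭)
open import Data.List.Relation.Binary.Permutation.Propositional using (_↭_)
open import Data.List.Relation.Binary.Sublist.Propositional using (_⊆_)
open import Data.List.Relation.Binary.Sublist.Propositional.Properties using (filter-⊆)
open import Data.List.Relation.Binary.Sublist.Heterogeneous using ([]; _∷_; _∷ʳ_)
open import Data.List.Relation.Unary.All as All using (All; []; _∷_; all?)
import Data.List.Relation.Unary.All.Properties as AllP
open import Data.List.Relation.Unary.Any using (Any; any?; here; there)
open import Data.List.Relation.Unary.Unique.Propositional using (Unique; []; _∷_)
import Data.List.Relation.Unary.Unique.Propositional.Properties as Unique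
open import Data.List.Relation.Unary.Unique.DecPropositional _≟_ using (unique?)
open import Data.Product using (∃; ∃₂; _×_; _,_; proj₁; proj₂)
open import Data.Sum using (_⊎_; inj₁; inj₂; [_,_]′)
open import Function using (_∘_)
open import Function.Bundles using (_⇔_; mk⇔)
open import Induction.WellFounded using (Acc; acc)
open import Relation.Nullary using (¬_; Dec; yes; no; ¬?; contradiction)
open import Relation.Nullary.Decidable using (True; toWitness; from-yes; map′; _×-dec_; _⊎-dec_; _→-dec_)
open import Relation.Binary.PropositionalEquality

private variable a b c d d′ e e′ k m n p s x : ℕ

-- Divisor lists and σ

divisor-nonZero : .{{NonZero n}} → d ∣ n → NonZero d
divisor-nonZero {n} {zero}  0∣n = contradiction (0∣⇒≡0 0∣n) (≢-nonZero⁻¹ n)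
divisor-nonZero {n} {suc d} _   = _

∈-divisors⁻ : x ∈ divisors n → x ∣ n
∈-divisors⁻ {n = n} x∈ = proj₂ (∈-filter⁻ (_∣? n) {xs = applyUpTo suc n} x∈)

∈-divisors⁺ : .{{NonZero n}} → x ∣ n → x ∈ divisors n
∈-divisors⁺ {n} {zero}  0∣n = contradiction (0∣⇒≡0 0∣n) (≢-nonZero⁻¹ n)
∈-divisors⁺ {n} {suc x} x∣n = ∈-filter⁺ (_∣? n) (∈-applyUpTo⁺ suc (∣⇒≤ x∣n)) x∣n

divisors-unique : ∀ n → Unique (divisors n)
divisors-unique n = Unique.filter⁺ (_∣? n) (Unique.applyUpTo⁺₁ suc n (λ i<j _ → <⇒≢ i<j ∘ suc-injective))

unique∧set⇒↭ : {xs ys : List ℕ} → Unique xs → Unique ys →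
  (∀ {x} → x ∈ xs → x ∈ ys) → (∀ {x} → x ∈ ys → x ∈ xs) → xs ↭ ys
unique∧set⇒↭ u v to from = ∼bag⇒↭ (unique∧set⇒bag u v (mk⇔ to from))

σ≡sum : .{{NonZero n}} → {xs : List ℕ} → Unique xs →
  (∀ {x} → x ∈ xs → x ∣ n) → (∀ {x} → x ∣ n → x ∈ xs) → σ n ≡ sum xs
σ≡sum {n} u sound complete =
  sum-↭ (unique∧set⇒↭ (divisors-unique n) u (complete ∘ ∈-divisors⁻) (∈-divisors⁺ ∘ sound))

-- The half-sum set is given by its elements, in any order, instead of as a sublist of divisors n.
Zumkellerˢ : ℕ → Set
Zumkellerˢ n = NonZero n × ∃ λ S → Unique S × All (_∣ n) S × sum S + sum S ≡ σ n

Zumkellerˢ⇒Zumkeller : Zumkellerˢ n → Zumkeller n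
Zumkellerˢ⇒Zumkeller {n} (n≢0 , S , S! , S∣n , half) =
  >-nonZero⁻¹ n {{n≢0}} , T , filter-⊆ (_∈? S) (divisors n) , subst (λ s → s + s ≡ σ n) (sum-↭ S↭T) half
  where
  instance _ = n≢0
  T = filter (_∈? S) (divisors n)
  S↭T : S ↭ T
  S↭T = unique∧set⇒↭ S! (Unique.filter⁺ (_∈? S) (divisors-unique n))
    (λ x∈S → ∈-filter⁺ (_∈? S) (∈-divisors⁺ (All.lookup S∣n x∈S)) x∈S)
    (λ x∈T → proj₂ (∈-filter⁻ (_∈? S) {xs = divisors n} x∈T))

-- Multiplicativity

sum-map-*ˡ : ∀ k (xs : List ℕ) → sum (map (k *_) xs) ≡ k * sum xs
sum-map-*ˡ k []       = sym (*-zeroʳ k)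
sum-map-*ˡ k (x ∷ xs) = trans (cong (k * x +_) (sum-map-*ˡ k xs)) (sym (*-distribˡ-+ k x (sum xs)))

sum-cartesianProduct-* : ∀ (xs ys : List ℕ) → sum (cartesianProductWith _*_ xs ys) ≡ sum xs * sum ys
sum-cartesianProduct-* []       ys = refl
sum-cartesianProduct-* (x ∷ xs) ys = begin
  sum (map (x *_) ys ++ cartesianProductWith _*_ xs ys)
    ≡⟨ sum-++ (map (x *_) ys) _ ⟩
  sum (map (x *_) ys) + sum (cartesianProductWith _*_ xs ys)
    ≡⟨ cong₂ _+_ (sum-map-*ˡ x ys) (sum-cartesianProduct-* xs ys) ⟩
  x * sum ys + sum xs * sum ys
    ≡⟨ *-distribʳ-+ (sum ys) x (sum xs) ⟨
  (x + sum xs) * sum ys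
    ∎
  where open ≡-Reasoning

coprime-∣ : Coprime a b → d ∣ a → e ∣ b → Coprime d e
coprime-∣ c d∣a e∣b (i∣d , i∣e) = c (∣-trans i∣d d∣a , ∣-trans i∣e e∣b)

coprime-*-injectiveˡ : Coprime a b → d ∣ a → d′ ∣ a → e ∣ b → e′ ∣ b → d * e ≡ d′ * e′ → d ≡ d′
coprime-*-injectiveˡ {d = d} {d′} {e} {e′} c d∣a d′∣a e∣b e′∣b eq = ∣-antisym
  (coprime-divisor (coprime-∣ c d∣a e′∣b) (subst (d ∣_) (trans eq (*-comm d′ e′)) (m∣m*n e)))
  (coprime-divisor (coprime-∣ c d′∣a e∣b) (subst (d′ ∣_) (trans (sym eq) (*-comm d e)) (m∣m*n e′)))

unique-cartesianProduct-* : .{{NonZero a}} → Coprime a b → {xs ys : List ℕ} →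
  All (_∣ a) xs → All (_∣ b) ys → Unique xs → Unique ys → Unique (cartesianProductWith _*_ xs ys)
unique-cartesianProduct-* c {[]}          []           ys∣b []          ys! = []
unique-cartesianProduct-* c {d ∷ xs} {ys} (d∣a ∷ xs∣a) ys∣b (d∉xs ∷ xs!) ys! =
  Unique.++⁺ (Unique.map⁺ (*-cancelˡ-≡ _ _ d {{divisor-nonZero d∣a}}) ys!)
             (unique-cartesianProduct-* c xs∣a ys∣b xs! ys!)
             disjoint
  where
  disjoint : ∀ {v} → ¬ (v ∈ map (d *_) ys × v ∈ cartesianProductWith _*_ xs ys)
  disjoint (v∈dys , v∈xsys) with ∈-map⁻ (d *_) v∈dys | ∈-cartesianProductWith⁻ _*_ xs ys v∈xsys
  ... | e , e∈ys , refl | d′ , e′ , d′∈xs , e′∈ys , eq = All.lookup d∉xs d′∈xs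
    (coprime-*-injectiveˡ c d∣a (All.lookup xs∣a d′∈xs) (All.lookup ys∣b e∈ys) (All.lookup ys∣b e′∈ys) eq)

coprime-∣-*⇒split : .{{NonZero a}} → Coprime a b → x ∣ a * b → ∃₂ λ d e → d ∣ a × e ∣ b × x ≡ d * e
coprime-∣-*⇒split {a} {b} {x} c x∣ab = g , x / g , gcd[m,n]∣n x a , x/g∣b , sym (m*[n/m]≡n g∣x)
  where
  g = gcd x a
  g∣x : g ∣ x
  g∣x = gcd[m,n]∣m x a
  instance _ = divisor-nonZero (gcd[m,n]∣n x a)
  x∣[a/g*b]*g : x ∣ (a / g * b) * g
  x∣[a/g*b]*g = subst (x ∣_) ab≡a/g*b*g x∣ab
    where
    open ≡-Reasoning
    ab≡a/g*b*g : a * b ≡ (a / g * b) * g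
    ab≡a/g*b*g = begin
      a * b           ≡⟨ cong (_* b) (m/n*n≡m (gcd[m,n]∣n x a)) ⟨
      a / g * g * b   ≡⟨ *-assoc (a / g) g b ⟩
      a / g * (g * b) ≡⟨ cong (a / g *_) (*-comm g b) ⟩
      a / g * (b * g) ≡⟨ *-assoc (a / g) b g ⟨
      a / g * b * g   ∎
  x/g∣b : x / g ∣ b
  x/g∣b = coprime-divisor (coprime-/gcd x a) (m∣n*o⇒m/n∣o g∣x x∣[a/g*b]*g)

all-∣-cartesianProduct-* : {xs ys : List ℕ} → All (_∣ a) xs → All (_∣ b) ys →
  All (_∣ a * b) (cartesianProductWith _*_ xs ys)
all-∣-cartesianProduct-* []           ys∣b = []
all-∣-cartesianProduct-* (d∣a ∷ xs∣a) ys∣b =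
  AllP.++⁺ (AllP.map⁺ (All.map (*-pres-∣ d∣a) ys∣b)) (all-∣-cartesianProduct-* xs∣a ys∣b)

divisors-all-∣ : ∀ n → All (_∣ n) (divisors n)
divisors-all-∣ n = All.tabulate ∈-divisors⁻

σ-multiplicative : .{{NonZero a}} → .{{NonZero b}} → Coprime a b → σ (a * b) ≡ σ a * σ b
σ-multiplicative {a} {b} c = trans
  (σ≡sum {{m*n≢0 a b}}
    (unique-cartesianProduct-* c (divisors-all-∣ a) (divisors-all-∣ b) (divisors-unique a) (divisors-unique b))
    (All.lookup (all-∣-cartesianProduct-* (divisors-all-∣ a) (divisors-all-∣ b))) complete)
  (sum-cartesianProduct-* (divisors a) (divisors b))
  where
  complete : ∀ {x} → x ∣ a * b → x ∈ cartesianProductWith _*_ (divisors a) (divisors b)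
  complete x∣ab with coprime-∣-*⇒split c x∣ab
  ... | d , e , d∣a , e∣b , refl = ∈-cartesianProductWith⁺ _*_ (∈-divisors⁺ d∣a) (∈-divisors⁺ e∣b)

Zumkellerˢ-*-coprime : Zumkellerˢ a → .{{NonZero b}} → Coprime a b → Zumkellerˢ (a * b)
Zumkellerˢ-*-coprime {a} {b} (a≢0 , S , S! , S∣a , half) c =
  m*n≢0 a b , T , unique-cartesianProduct-* c S∣a (divisors-all-∣ b) S! (divisors-unique b) ,
  all-∣-cartesianProduct-* S∣a (divisors-all-∣ b) , T-half
  where
  instance _ = a≢0
  T = cartesianProductWith _*_ S (divisors b)
  T-half : sum T + sum T ≡ σ (a * b)
  T-half = begin
    sum T + sum T               ≡⟨ cong (λ t → t + t) (sum-cartesianProduct-* S (divisors b)) ⟩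
    sum S * σ b + sum S * σ b   ≡⟨ *-distribʳ-+ (σ b) (sum S) (sum S) ⟨
    (sum S + sum S) * σ b       ≡⟨ cong (_* σ b) half ⟩
    σ a * σ b                   ≡⟨ σ-multiplicative c ⟨
    σ (a * b)                   ∎
    where open ≡-Reasoning

-- The Zumkeller numbers 88 w with 11 ∤ w

coprime-*ˡ : Coprime a c → Coprime b c → Coprime (a * b) c
coprime-*ˡ a⊥c b⊥c (d∣ab , d∣c) =
  b⊥c (coprime-divisor (λ (i∣d , i∣a) → a⊥c (i∣a , ∣-trans i∣d d∣c)) d∣ab , d∣c)

coprime-^ˡ : ∀ k → Coprime a c → Coprime (a ^ k) c
coprime-^ˡ zero    a⊥c (i∣1 , _) = ∣1⇒≡1 i∣1
coprime-^ˡ (suc k) a⊥c = coprime-*ˡ a⊥c (coprime-^ˡ k a⊥c)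

prime∤⇒coprime : Prime p → ¬ p ∣ n → Coprime p n
prime∤⇒coprime pp p∤n (i∣p , i∣n) with prime⇒irreducible pp i∣p
... | inj₁ i≡1 = i≡1
... | inj₂ refl = contradiction i∣n p∤n

oddPart : ∀ n → .{{NonZero n}} → ∃₂ λ k u → ¬ 2 ∣ u × n ≡ 2 ^ k * u
oddPart n = go n (<-wellFounded n)
  where
  go : ∀ m → Acc _<_ m → .{{NonZero m}} → ∃₂ λ k u → ¬ 2 ∣ u × m ≡ 2 ^ k * u
  go m (acc smaller) with 2 ∣? m
  ... | no 2∤m = 0 , m , 2∤m , sym (*-identityˡ m)
  ... | yes (divides q refl) with q≢0 ← m*n≢0⇒m≢0 q | go q (smaller (m<m*n q 2 {{q≢0}} ≤-refl)) {{q≢0}}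
  ...   | k , u , 2∤u , q≡2^k*u = suc k , u , 2∤u , (begin
    q * 2           ≡⟨ *-comm q 2 ⟩
    2 * q           ≡⟨ cong (2 *_) q≡2^k*u ⟩
    2 * (2 ^ k * u) ≡⟨ *-assoc 2 (2 ^ k) u ⟨
    2 ^ suc k * u   ∎)
    where open ≡-Reasoning

powersOfTwo : ℕ → List ℕ
powersOfTwo zero    = 1 ∷ []
powersOfTwo (suc k) = 1 ∷ map (2 *_) (powersOfTwo k)

∈-powersOfTwo⁻ : ∀ k → x ∈ powersOfTwo k → x ∣ 2 ^ k
∈-powersOfTwo⁻ zero    (here refl) = ∣-refl
∈-powersOfTwo⁻ (suc k) (here refl) = 1∣ _
∈-powersOfTwo⁻ (suc k) (there x∈) with ∈-map⁻ (2 *_) x∈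
... | y , y∈ , refl = *-pres-∣ (∣-refl {2}) (∈-powersOfTwo⁻ k y∈)

∈-powersOfTwo⁺ : ∀ k → x ∣ 2 ^ k → x ∈ powersOfTwo k
∈-powersOfTwo⁺ zero x∣1 rewrite ∣1⇒≡1 x∣1 = here refl
∈-powersOfTwo⁺ {x} (suc k) x∣2^k with 2 ∣? x
... | no 2∤x = here (coprime-^ˡ (suc k) (prime∤⇒coprime prime[2] 2∤x) (x∣2^k , ∣-refl))
... | yes (divides y refl) =
  there (subst (_∈ map (2 *_) (powersOfTwo k)) (*-comm 2 y) (∈-map⁺ (2 *_) (∈-powersOfTwo⁺ k y∣2^k)))
  where
  y∣2^k : y ∣ 2 ^ k
  y∣2^k = *-cancelˡ-∣ {y} 2 (subst (_∣ 2 ^ suc k) (*-comm y 2) x∣2^k)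

powersOfTwo-unique : ∀ k → Unique (powersOfTwo k)
powersOfTwo-unique zero    = [] ∷ []
powersOfTwo-unique (suc k) = All.tabulate 1∉evens ∷ Unique.map⁺ (*-cancelˡ-≡ _ _ 2) (powersOfTwo-unique k)
  where
  1∉evens : ∀ {y} → y ∈ map (2 *_) (powersOfTwo k) → 1 ≢ y
  1∉evens y∈ 1≡y with ∈-map⁻ (2 *_) y∈
  ... | z , _ , refl with () ← ∣1⇒≡1 (subst (2 ∣_) (sym 1≡y) (m∣m*n z))

sum-powersOfTwo : ∀ k → sum (powersOfTwo k) + 1 ≡ 2 ^ suc k
sum-powersOfTwo zero    = refl
sum-powersOfTwo (suc k) = begin
  1 + sum (map (2 *_) (powersOfTwo k)) + 1
    ≡⟨ cong (λ s → 1 + s + 1) (sum-map-*ˡ 2 (powersOfTwo k)) ⟩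
  1 + 2 * sum (powersOfTwo k) + 1
    ≡⟨ solve 1 (λ s → con 1 :+ con 2 :* s :+ con 1 := con 2 :* (s :+ con 1)) refl (sum (powersOfTwo k)) ⟩
  2 * (sum (powersOfTwo k) + 1)
    ≡⟨ cong (2 *_) (sum-powersOfTwo k) ⟩
  2 ^ suc (suc k)
    ∎
  where open ≡-Reasoning
        open +-*-Solver

σ-2^ : ∀ k → σ (2 ^ k) ≡ sum (powersOfTwo k)
σ-2^ k = σ≡sum {{m^n≢0 2 k}} (powersOfTwo-unique k) (∈-powersOfTwo⁻ k) (∈-powersOfTwo⁺ k)

∉-multiples : ∀ m {x} (xs : List ℕ) → ¬ m ∣ x → All (x ≢_) (map (m *_) xs)
∉-multiples m xs m∤x = AllP.map⁺ (All.tabulate λ {y} _ x≡m*y → m∤x (subst (m ∣_) (sym x≡m*y) (m∣m*n y)))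

11∤2^ : ∀ k → ¬ 11 ∣ 2 ^ k
11∤2^ k 11∣2^k with () ← coprime-^ˡ k (from-yes (coprime? 2 11)) (11∣2^k , ∣-refl)

-- σ (2 ^ (3 + j) * 11) / 2 = 6 * (2 ^ (4 + j) - 1) = 1 + 4 + 2 ^ (3 + j) + 11 * (2 ^ (3 + j) - 1)
zumkellerˢ-2^[3+j]*11 : ∀ j → Zumkellerˢ (2 ^ (3 + j) * 11)
zumkellerˢ-2^[3+j]*11 j = m*n≢0 A 11 , S , S! , S∣A*11 , half
  where
  A = 2 ^ (3 + j)
  instance _ = m^n≢0 2 (3 + j)
  P = sum (powersOfTwo (2 + j))
  L = map (11 *_) (powersOfTwo (2 + j))
  S = 1 ∷ 4 ∷ A ∷ L

  8≤A : 8 ≤ A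
  8≤A = ^-monoʳ-≤ 2 (m≤m+n 3 j)
  S! : Unique S
  S! = ((λ ()) ∷ <⇒≢ (<-≤-trans (from-yes (1 <? 8)) 8≤A) ∷ ∉-multiples 11 (powersOfTwo (2 + j)) (11∤2^ 0))
     ∷ (<⇒≢ (<-≤-trans (from-yes (4 <? 8)) 8≤A) ∷ ∉-multiples 11 (powersOfTwo (2 + j)) (11∤2^ 2))
     ∷ ∉-multiples 11 (powersOfTwo (2 + j)) (11∤2^ (3 + j))
     ∷ Unique.map⁺ (*-cancelˡ-≡ _ _ 11) (powersOfTwo-unique (2 + j))

  S∣A*11 : All (_∣ A * 11) S
  S∣A*11 = 1∣ _
         ∷ ∣-trans (∈-powersOfTwo⁻ (3 + j) (there (there (here refl)))) (m∣m*n 11)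
         ∷ m∣m*n 11
         ∷ AllP.map⁺ (All.tabulate λ {y} y∈ → subst (_∣ A * 11) (*-comm y 11)
             (*-pres-∣ (∣-trans (∈-powersOfTwo⁻ (2 + j) y∈) (n∣m*n 2)) ∣-refl))

  sumS : sum S ≡ 1 + (4 + ((P + 1) + 11 * P))
  sumS = cong₂ (λ A′ ΣL → 1 + (4 + (A′ + ΣL))) (sym (sum-powersOfTwo (2 + j))) (sum-map-*ˡ 11 (powersOfTwo (2 + j)))
  σA : σ A ≡ 1 + 2 * P
  σA = trans (σ-2^ (3 + j)) (cong (1 +_) (sum-map-*ˡ 2 (powersOfTwo (2 + j))))
  half : sum S + sum S ≡ σ (A * 11)
  half = begin
    sum S + sum S
      ≡⟨ cong (λ t → t + t) sumS ⟩
    (1 + (4 + ((P + 1) + 11 * P))) + (1 + (4 + ((P + 1) + 11 * P)))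
      ≡⟨ solve 1 (λ P → let t = con 1 :+ (con 4 :+ ((P :+ con 1) :+ con 11 :* P)) in t :+ t := (con 1 :+ con 2 :* P) :* con 12)
               refl P ⟩
    (1 + 2 * P) * 12
      ≡⟨ cong (_* 12) σA ⟨
    σ A * σ 11
      ≡⟨ σ-multiplicative (coprime-^ˡ (3 + j) (from-yes (coprime? 2 11))) ⟨
    σ (A * 11) ∎
    where open ≡-Reasoning
          open +-*-Solver

-- x = 88 * w with 11 ∤ w
Family88 : ℕ → Set
Family88 x = 88 ∣ x × ¬ 968 ∣ x

family88? : ∀ x → Dec (Family88 x)
family88? x = 88 ∣? x ×-dec ¬? (968 ∣? x)

zumkeller-family88 : Family88 x → Zumkeller x
zumkeller-family88 (divides w refl , 968∤w*88) = split (oddPart w {{w≢0}})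
  where
  w≢0 : NonZero w
  w≢0 = ≢-nonZero λ { refl → 968∤w*88 (968 ∣0) }
  split : (∃₂ λ k u → ¬ 2 ∣ u × w ≡ 2 ^ k * u) → Zumkeller (w * 88)
  split (k , u , 2∤u , w≡2^k*u) = Zumkellerˢ⇒Zumkeller (subst Zumkellerˢ regroup
      (Zumkellerˢ-*-coprime (zumkellerˢ-2^[3+j]*11 k) {{u≢0}} (coprime-*ˡ 2^[3+k]⊥u 11⊥u)))
    where
    u≢0 : NonZero u
    u≢0 = ≢-nonZero λ { refl → 2∤u (2 ∣0) }
    2^[3+k]⊥u : Coprime (2 ^ (3 + k)) u
    2^[3+k]⊥u = coprime-^ˡ (3 + k) (prime∤⇒coprime prime[2] 2∤u)
    11⊥u : Coprime 11 u
    11⊥u = prime∤⇒coprime (from-yes (prime? 11)) λ 11∣u →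
      968∤w*88 (*-pres-∣ (subst (11 ∣_) (sym w≡2^k*u) (∣-trans 11∣u (n∣m*n (2 ^ k)))) (∣-refl {88}))
    regroup : 2 ^ (3 + k) * 11 * u ≡ w * 88
    regroup = trans (solve 2 (λ p u → con 2 :* (con 2 :* (con 2 :* p)) :* con 11 :* u := p :* u :* con 88) refl (2 ^ k) u)
                    (cong (_* 88) (sym w≡2^k*u))
      where open +-*-Solver

family88-+968 : Family88 x → ∀ q → Family88 (x + q * 968)
family88-+968 (88∣x , 968∤x) q =
  ∣m∣n⇒∣m+n 88∣x (∣-trans (divides 11 refl) (n∣m*n q)) ,
  λ 968∣x+q*968 → 968∤x (∣m+n∣m⇒∣n (subst (968 ∣_) (+-comm _ (q * 968)) 968∣x+q*968) (n∣m*n q))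

-- Sums of two Zumkeller numbers in a residue class mod 968

sumOfTwoZumkeller-+968 : Zumkeller a → Family88 (m ∸ a) → ∀ q → SumOfTwoZumkeller (m + q * 968)
sumOfTwoZumkeller-+968 {a} {m} Za fam q =
  a , m ∸ a + q * 968 , Za , zumkeller-family88 (family88-+968 fam q) , regroup
  where
  a≤m : a ≤ m
  a≤m = ≮⇒≥ λ m<a → proj₂ fam (subst (968 ∣_) (sym (m≤n⇒m∸n≡0 (<⇒≤ m<a))) (968 ∣0))
  regroup : a + (m ∸ a + q * 968) ≡ m + q * 968
  regroup = trans (sym (+-assoc a (m ∸ a) _)) (cong (_+ q * 968) (m+[n∸m]≡n a≤m))

sumOfTwoZumkeller-window : (Q : ℕ → Set) → (∀ m q → Q (m + q * 968) → Q m) →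
  {zs : List ℕ} → All Zumkeller zs → ∀ N →
  (∀ {t} → t < 968 → Q (N + t) → Any (λ a → Family88 (N + t ∸ a)) zs) →
  ∀ {n} → N ≤ n → Q n → SumOfTwoZumkeller n
sumOfTwoZumkeller-window Q Q-periodic {zs} Zzs N window {n} N≤n Qn =
  subst SumOfTwoZumkeller (sym n≡) (split (find (window (m%n<n (n ∸ N) 968) (Q-periodic (N + r) q (subst Q n≡ Qn)))))
  where
  r = (n ∸ N) % 968
  q = (n ∸ N) / 968
  n≡ : n ≡ N + r + q * 968
  n≡ = trans (sym (m+[n∸m]≡n N≤n)) (trans (cong (N +_) (m≡m%n+[m/n]*n (n ∸ N) 968)) (sym (+-assoc N r _)))
  split : (∃ λ a → a ∈ zs × Family88 (N + r ∸ a)) → SumOfTwoZumkeller (N + r + q * 968)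
  split (a , a∈zs , fam) = sumOfTwoZumkeller-+968 (All.lookup Zzs a∈zs) fam q

-- Certificates and finite checks

-- For n < (s + 1)², every divisor of n is some d ≤ s or its cofactor n / d; unlike divisors n,
-- this list costs only s divisibility tests to compute.
pairedDivisors : ℕ → ℕ → List ℕ
pairedDivisors n s = concatMap (λ i → suc i ∷ n / suc i ∷ []) (filter (λ i → suc i ∣? n) (upTo s))

∈-pairedDivisors⁻ : ∀ s → x ∈ pairedDivisors n s → x ∣ n
∈-pairedDivisors⁻ {n = n} s x∈
  with find (∈-concatMap⁻ (λ i → suc i ∷ n / suc i ∷ []) {xs = filter (λ i → suc i ∣? n) (upTo s)} x∈)
... | i , i∈ , here refl         = proj₂ (∈-filter⁻ (λ i → suc i ∣? n) {xs = upTo s} i∈)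
... | i , i∈ , there (here refl) = m/n∣m (proj₂ (∈-filter⁻ (λ i → suc i ∣? n) {xs = upTo s} i∈))

∈-pairedDivisors-pair : ∀ d .{{_ : NonZero d}} → d ∣ n → d ≤ s → x ∈ d ∷ n / d ∷ [] → x ∈ pairedDivisors n s
∈-pairedDivisors-pair {n} {s} (suc i) d∣n d≤s x∈ =
  ∈-concatMap⁺ (λ i → suc i ∷ n / suc i ∷ []) (lose (∈-filter⁺ (λ i → suc i ∣? n) (∈-upTo⁺ d≤s) d∣n) x∈)

∈-pairedDivisors⁺ : .{{NonZero n}} → n < suc s * suc s → x ∣ n → x ∈ pairedDivisors n s
∈-pairedDivisors⁺ {n} {s} {x} n<[1+s]² x∣n with x ≤? s
... | yes x≤s = ∈-pairedDivisors-pair x {{divisor-nonZero x∣n}} x∣n x≤s (here refl)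
... | no  x≰s = ∈-pairedDivisors-pair y y∣n y≤s (there (here (sym n/y≡x)))
  where
  instance _ = divisor-nonZero x∣n
  y = n / x
  xy≡n : x * y ≡ n
  xy≡n = m*[n/m]≡n x∣n
  y∣n : y ∣ n
  y∣n = divides x (sym xy≡n)
  instance _ = divisor-nonZero y∣n
  y≤s : y ≤ s
  y≤s = ≮⇒≥ λ s<y → <⇒≱ n<[1+s]² (subst (suc s * suc s ≤_) xy≡n (*-mono-≤ (≰⇒> x≰s) s<y))
  n/y≡x : n / y ≡ x
  n/y≡x = trans (cong (_/ y) (sym xy≡n)) (m*n/n≡m x y)

ZumkellerCertificate : ℕ → ℕ → List ℕ → Set
ZumkellerCertificate n s S = 0 < n × n < suc s * suc s × Unique (pairedDivisors n s)
  × Unique S × All (_∣ n) S × sum S + sum S ≡ sum (pairedDivisors n s)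

zumkellerCertificate? : ∀ n s S → Dec (ZumkellerCertificate n s S)
zumkellerCertificate? n s S = 0 <? n ×-dec n <? suc s * suc s ×-dec unique? (pairedDivisors n s)
  ×-dec unique? S ×-dec all? (_∣? n) S ×-dec sum S + sum S ≟ sum (pairedDivisors n s)

certificate⇒Zumkellerˢ : ∀ {S} → ZumkellerCertificate n s S → Zumkellerˢ n
certificate⇒Zumkellerˢ {n} {s} {S} (0<n , n<[1+s]² , D! , S! , S∣n , half) =
  n≢0 , S , S! , S∣n ,
  trans half (sym (σ≡sum {{n≢0}} D! (∈-pairedDivisors⁻ s) (∈-pairedDivisors⁺ {s = s} {{n≢0}} n<[1+s]²)))
  where
  n≢0 : NonZero n
  n≢0 = >-nonZero 0<n

SublistSum : (ℕ → Set) → List ℕ → Set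
SublistSum P xs = ∃ λ S → S ⊆ xs × P (sum S)

sublistSum? : {P : ℕ → Set} → (∀ s → Dec (P s)) → ∀ xs → Dec (SublistSum P xs)
sublistSum? P? []       = map′ (λ p → [] , [] , p) (λ { ([] , [] , p) → p }) (P? 0)
sublistSum? {P} P? (x ∷ xs) =
  map′ [ skip , keep ]′ split (sublistSum? P? xs ⊎-dec sublistSum? (λ s → P? (x + s)) xs)
  where
  skip : SublistSum P xs → SublistSum P (x ∷ xs)
  skip (S , S⊆xs , p) = S , x ∷ʳ S⊆xs , p
  keep : SublistSum (λ s → P (x + s)) xs → SublistSum P (x ∷ xs)
  keep (S , S⊆xs , p) = x ∷ S , refl ∷ S⊆xs , p
  split : SublistSum P (x ∷ xs) → SublistSum P xs ⊎ SublistSum (λ s → P (x + s)) xs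
  split (S , _ ∷ʳ S⊆xs , p)        = inj₁ (S , S⊆xs , p)
  split (_ ∷ S , refl ∷ S⊆xs , p) = inj₂ (S , S⊆xs , p)

zumkeller? : ∀ n → Dec (Zumkeller n)
zumkeller? n = 1 ≤? n ×-dec sublistSum? (λ s → s + s ≟ σ n) (divisors n)

zumkeller<39 : List ℕ
zumkeller<39 = 6 ∷ 12 ∷ 20 ∷ 24 ∷ 28 ∷ 30 ∷ []

∈-zumkeller<39 : ∀ {z} → z < 39 → Zumkeller z → z ∈ zumkeller<39
∈-zumkeller<39 = toWitness {a? = allUpTo? (λ z → zumkeller? z →-dec z ∈? zumkeller<39) 39} _

-- Entries (n , ⌊√n⌋ , S) with S a set of divisors of n summing to σ n / 2.
certificates : List (ℕ × ℕ × List ℕ)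
certificates =
  (6 , 2 , 6 ∷ []) ∷
  (12 , 3 , 2 ∷ 12 ∷ []) ∷
  (20 , 4 , 1 ∷ 20 ∷ []) ∷
  (24 , 4 , 6 ∷ 24 ∷ []) ∷
  (28 , 5 , 28 ∷ []) ∷
  (30 , 5 , 6 ∷ 30 ∷ []) ∷
  (40 , 6 , 5 ∷ 40 ∷ []) ∷
  (42 , 6 , 6 ∷ 42 ∷ []) ∷
  (48 , 6 , 2 ∷ 12 ∷ 48 ∷ []) ∷
  (54 , 7 , 6 ∷ 54 ∷ []) ∷
  (56 , 7 , 4 ∷ 56 ∷ []) ∷
  (60 , 7 , 4 ∷ 20 ∷ 60 ∷ []) ∷
  (66 , 8 , 6 ∷ 66 ∷ []) ∷
  (70 , 8 , 2 ∷ 70 ∷ []) ∷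
  (78 , 8 , 6 ∷ 78 ∷ []) ∷
  (80 , 8 , 1 ∷ 2 ∷ 10 ∷ 80 ∷ []) ∷
  (84 , 9 , 28 ∷ 84 ∷ []) ∷
  (88 , 9 , 2 ∷ 88 ∷ []) ∷
  (90 , 9 , 9 ∷ 18 ∷ 90 ∷ []) ∷
  (96 , 9 , 6 ∷ 24 ∷ 96 ∷ []) ∷
  (102 , 10 , 6 ∷ 102 ∷ []) ∷
  (104 , 10 , 1 ∷ 104 ∷ []) ∷
  (108 , 10 , 1 ∷ 4 ∷ 27 ∷ 108 ∷ []) ∷
  (112 , 10 , 4 ∷ 8 ∷ 112 ∷ []) ∷
  (114 , 10 , 6 ∷ 114 ∷ []) ∷
  (120 , 10 , 60 ∷ 120 ∷ []) ∷
  (126 , 11 , 9 ∷ 21 ∷ 126 ∷ []) ∷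
  (132 , 11 , 3 ∷ 33 ∷ 132 ∷ []) ∷
  (138 , 11 , 6 ∷ 138 ∷ []) ∷
  (140 , 11 , 28 ∷ 140 ∷ []) ∷
  (150 , 12 , 6 ∷ 30 ∷ 150 ∷ []) ∷
  (156 , 12 , 1 ∷ 39 ∷ 156 ∷ []) ∷
  (160 , 12 , 1 ∷ 8 ∷ 20 ∷ 160 ∷ []) ∷
  (168 , 12 , 2 ∷ 14 ∷ 56 ∷ 168 ∷ []) ∷
  (174 , 13 , 6 ∷ 174 ∷ []) ∷
  (176 , 13 , 2 ∷ 8 ∷ 176 ∷ []) ∷
  (180 , 13 , 3 ∷ 90 ∷ 180 ∷ []) ∷
  (186 , 13 , 6 ∷ 186 ∷ []) ∷
  (192 , 13 , 2 ∷ 12 ∷ 48 ∷ 192 ∷ []) ∷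
  (198 , 14 , 3 ∷ 33 ∷ 198 ∷ []) ∷
  (204 , 14 , 2 ∷ 12 ∷ 34 ∷ 204 ∷ []) ∷
  (208 , 14 , 1 ∷ 8 ∷ 208 ∷ []) ∷
  (210 , 14 , 1 ∷ 7 ∷ 70 ∷ 210 ∷ []) ∷
  (216 , 14 , 12 ∷ 72 ∷ 216 ∷ []) ∷
  (220 , 14 , 10 ∷ 22 ∷ 220 ∷ []) ∷
  (222 , 14 , 6 ∷ 222 ∷ []) ∷
  (224 , 14 , 28 ∷ 224 ∷ []) ∷
  (228 , 15 , 2 ∷ 12 ∷ 38 ∷ 228 ∷ []) ∷
  (234 , 15 , 39 ∷ 234 ∷ []) ∷
  (240 , 15 , 12 ∷ 120 ∷ 240 ∷ []) ∷
  (246 , 15 , 6 ∷ 246 ∷ []) ∷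
  (252 , 15 , 28 ∷ 84 ∷ 252 ∷ []) ∷
  (258 , 16 , 6 ∷ 258 ∷ []) ∷
  (260 , 16 , 1 ∷ 2 ∷ 5 ∷ 26 ∷ 260 ∷ []) ∷
  (270 , 16 , 90 ∷ 270 ∷ []) ∷
  (272 , 16 , 1 ∷ 2 ∷ 4 ∷ 272 ∷ []) ∷
  (276 , 16 , 2 ∷ 12 ∷ 46 ∷ 276 ∷ []) ∷
  (282 , 16 , 6 ∷ 282 ∷ []) ∷
  (294 , 17 , 6 ∷ 42 ∷ 294 ∷ []) ∷
  (300 , 17 , 4 ∷ 30 ∷ 100 ∷ 300 ∷ []) ∷
  (304 , 17 , 2 ∷ 4 ∷ 304 ∷ []) ∷
  (306 , 17 , 2 ∷ 9 ∷ 34 ∷ 306 ∷ []) ∷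
  (308 , 17 , 28 ∷ 308 ∷ []) ∷
  (318 , 17 , 6 ∷ 318 ∷ []) ∷
  (320 , 17 , 1 ∷ 20 ∷ 40 ∷ 320 ∷ []) ∷
  (330 , 18 , 3 ∷ 33 ∷ 66 ∷ 330 ∷ []) ∷
  (336 , 18 , 48 ∷ 112 ∷ 336 ∷ []) ∷
  (340 , 18 , 4 ∷ 34 ∷ 340 ∷ []) ∷
  (342 , 18 , 1 ∷ 9 ∷ 38 ∷ 342 ∷ []) ∷
  (350 , 18 , 1 ∷ 7 ∷ 14 ∷ 350 ∷ []) ∷
  (354 , 18 , 6 ∷ 354 ∷ []) ∷
  (366 , 19 , 6 ∷ 366 ∷ []) ∷
  (378 , 19 , 3 ∷ 9 ∷ 27 ∷ 63 ∷ 378 ∷ []) ∷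
  (390 , 19 , 6 ∷ 30 ∷ 78 ∷ 390 ∷ []) ∷
  (402 , 20 , 6 ∷ 402 ∷ []) ∷
  (414 , 20 , 2 ∷ 6 ∷ 46 ∷ 414 ∷ []) ∷
  (416 , 20 , 1 ∷ 8 ∷ 16 ∷ 416 ∷ []) ∷
  (420 , 20 , 42 ∷ 210 ∷ 420 ∷ []) ∷
  (426 , 20 , 6 ∷ 426 ∷ []) ∷
  (444 , 21 , 2 ∷ 12 ∷ 74 ∷ 444 ∷ []) ∷
  (462 , 21 , 1 ∷ 3 ∷ 33 ∷ 77 ∷ 462 ∷ []) ∷
  (474 , 21 , 6 ∷ 474 ∷ []) ∷
  (476 , 21 , 28 ∷ 476 ∷ []) ∷
  (486 , 22 , 6 ∷ 54 ∷ 486 ∷ []) ∷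
  (498 , 22 , 6 ∷ 498 ∷ []) ∷
  (500 , 22 , 1 ∷ 20 ∷ 25 ∷ 500 ∷ []) ∷
  (522 , 22 , 2 ∷ 3 ∷ 58 ∷ 522 ∷ []) ∷
  (546 , 23 , 2 ∷ 7 ∷ 26 ∷ 91 ∷ 546 ∷ []) ∷
  (690 , 26 , 6 ∷ 30 ∷ 138 ∷ 690 ∷ []) ∷
  (714 , 26 , 3 ∷ 7 ∷ 21 ∷ 119 ∷ 714 ∷ []) ∷
  (945 , 30 , 15 ∷ 945 ∷ []) ∷
  (1575 , 39 , 3 ∷ 9 ∷ 25 ∷ 1575 ∷ []) ∷
  (2205 , 46 , 3 ∷ 15 ∷ 2205 ∷ []) ∷
  (2835 , 53 , 1 ∷ 5 ∷ 63 ∷ 2835 ∷ []) ∷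
  (4095 , 63 , 273 ∷ 4095 ∷ []) ∷
  (4725 , 68 , 1 ∷ 9 ∷ 225 ∷ 4725 ∷ []) ∷
  (5355 , 73 , 1 ∷ 5 ∷ 255 ∷ 5355 ∷ []) ∷
  (5985 , 77 , 21 ∷ 63 ∷ 171 ∷ 5985 ∷ []) ∷
  (6615 , 81 , 1 ∷ 35 ∷ 189 ∷ 6615 ∷ []) ∷
  (6825 , 82 , 1 ∷ 13 ∷ 105 ∷ 6825 ∷ []) ∷
  (7875 , 88 , 3 ∷ 9 ∷ 225 ∷ 7875 ∷ []) ∷
  (8925 , 94 , 3 ∷ 8925 ∷ []) ∷
  (11655 , 107 , 1 ∷ 15 ∷ 185 ∷ 11655 ∷ []) ∷
  (13545 , 116 , 9 ∷ 45 ∷ 129 ∷ 13545 ∷ []) ∷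
  (14805 , 121 , 9 ∷ 21 ∷ 141 ∷ 14805 ∷ []) ∷
  (15435 , 124 , 3 ∷ 15 ∷ 147 ∷ 15435 ∷ []) ∷
  (16695 , 129 , 3 ∷ 45 ∷ 105 ∷ 16695 ∷ []) ∷
  (18585 , 136 , 9 ∷ 21 ∷ 105 ∷ 18585 ∷ []) ∷
  (19215 , 138 , 3 ∷ 21 ∷ 105 ∷ 19215 ∷ []) ∷
  (19845 , 140 , 1 ∷ 5 ∷ 105 ∷ 735 ∷ 19845 ∷ []) ∷
  (21105 , 145 , 1 ∷ 5 ∷ 105 ∷ 21105 ∷ []) ∷
  (23625 , 153 , 21 ∷ 189 ∷ 1125 ∷ 23625 ∷ []) ∷
  (24885 , 157 , 3 ∷ 9 ∷ 63 ∷ 24885 ∷ []) ∷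
  (25515 , 159 , 15 ∷ 135 ∷ 567 ∷ 25515 ∷ []) ∷
  (31815 , 178 , 9 ∷ 31815 ∷ []) ∷
  (33075 , 181 , 1 ∷ 3 ∷ 7 ∷ 49 ∷ 2205 ∷ 33075 ∷ []) ∷
  (33915 , 184 , 15 ∷ 35 ∷ 595 ∷ 33915 ∷ []) ∷
  (42525 , 206 , 1 ∷ 3 ∷ 15 ∷ 567 ∷ 2025 ∷ 42525 ∷ []) ∷
  (53235 , 230 , 39 ∷ 273 ∷ 3549 ∷ 53235 ∷ []) ∷
  (58695 , 242 , 1 ∷ 3 ∷ 7 ∷ 129 ∷ 301 ∷ 58695 ∷ []) ∷
  (69825 , 264 , 15 ∷ 105 ∷ 735 ∷ 69825 ∷ []) ∷
  (84525 , 290 , 1 ∷ 3 ∷ 7 ∷ 35 ∷ 245 ∷ 84525 ∷ []) ∷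
  []

coprimeMultiples : List (ℕ × List ℕ)
coprimeMultiples =
  (945 , 1 ∷ 11 ∷ 13 ∷ 17 ∷ 19 ∷ 23 ∷ 29 ∷ 31 ∷ 37 ∷ 41 ∷ 43 ∷ 47 ∷ 53 ∷ 59 ∷ 67 ∷ 71 ∷ 73 ∷ 79 ∷ 83 ∷ []) ∷
  (1575 , 1 ∷ 11 ∷ 13 ∷ 17 ∷ 19 ∷ 23 ∷ 29 ∷ 31 ∷ 37 ∷ 41 ∷ 43 ∷ 47 ∷ 53 ∷ []) ∷
  (2205 , 1 ∷ 11 ∷ 13 ∷ 17 ∷ 19 ∷ 23 ∷ 29 ∷ 31 ∷ 37 ∷ 41 ∷ []) ∷
  (2835 , 1 ∷ 11 ∷ 13 ∷ 17 ∷ 19 ∷ 23 ∷ 29 ∷ 31 ∷ []) ∷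
  (4095 , 1 ∷ 11 ∷ 17 ∷ 19 ∷ 23 ∷ []) ∷
  (4725 , 1 ∷ 11 ∷ 13 ∷ 17 ∷ 19 ∷ []) ∷
  (5355 , 1 ∷ 11 ∷ []) ∷
  (5985 , 1 ∷ 11 ∷ []) ∷
  (6615 , 1 ∷ []) ∷
  (6825 , 1 ∷ []) ∷
  (7875 , 1 ∷ []) ∷
  (8925 , 1 ∷ []) ∷
  (11655 , 1 ∷ []) ∷
  (13545 , 1 ∷ []) ∷
  (14805 , 1 ∷ []) ∷
  (15435 , 1 ∷ []) ∷
  (16695 , 1 ∷ []) ∷
  (18585 , 1 ∷ []) ∷
  (19215 , 1 ∷ []) ∷
  (19845 , 1 ∷ []) ∷
  (21105 , 1 ∷ []) ∷
  (23625 , 1 ∷ []) ∷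
  (24885 , 1 ∷ []) ∷
  (25515 , 1 ∷ []) ∷
  (31815 , 1 ∷ []) ∷
  (33075 , 1 ∷ []) ∷
  (33915 , 1 ∷ []) ∷
  (42525 , 1 ∷ []) ∷
  (53235 , 1 ∷ []) ∷
  (58695 , 1 ∷ []) ∷
  (69825 , 1 ∷ []) ∷
  (84525 , 1 ∷ []) ∷
  []

exceptions : List ℕ
exceptions = 14 ∷ 16 ∷ 20 ∷ 22 ∷ 28 ∷ 38 ∷ []

smallSummands : List ℕ
smallSummands =
  6 ∷ 12 ∷ 20 ∷ 24 ∷ 28 ∷ 30 ∷ 40 ∷ 42 ∷ 54 ∷ 60 ∷ 66 ∷ 70 ∷ 78 ∷ 80 ∷ 88 ∷ 90 ∷
  96 ∷ 104 ∷ 114 ∷ 132 ∷ 150 ∷ 176 ∷ 180 ∷ 186 ∷ 204 ∷ 208 ∷ 282 ∷ 304 ∷ 308 ∷ 330 ∷ 336 ∷ []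

certifiedZumkeller : List ℕ
certifiedZumkeller = map proj₁ certificates

zumkellerˢ-certified : ∀ {z} → z ∈ certifiedZumkeller → Zumkellerˢ z
zumkellerˢ-certified z∈ with ∈-map⁻ proj₁ {xs = certificates} z∈
... | (_ , s , S) , c∈ , refl = certificate⇒Zumkellerˢ {s = s} {S} (All.lookup certified c∈)
  where
  certified : All (λ (n , s , S) → ZumkellerCertificate n s S) certificates
  certified = toWitness {a? = all? (λ (n , s , S) → zumkellerCertificate? n s S) certificates} _

zumkeller-certified : ∀ {z} → z ∈ certifiedZumkeller → Zumkeller z
zumkeller-certified = Zumkellerˢ⇒Zumkeller ∘ zumkellerˢ-certified

zumkeller-coprimeMultiple : b ∈ certifiedZumkeller → 0 < k × Coprime b k → Zumkeller (b * k)
zumkeller-coprimeMultiple b∈ (0<k , b⊥k) =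
  Zumkellerˢ⇒Zumkeller (Zumkellerˢ-*-coprime (zumkellerˢ-certified b∈) {{>-nonZero 0<k}} b⊥k)

oddSummands : List ℕ
oddSummands = concatMap (λ (b , ks) → map (b *_) ks) coprimeMultiples

oddSummands-zumkeller : All Zumkeller oddSummands
oddSummands-zumkeller =
  AllP.concat⁺ (AllP.map⁺ (All.map (λ (b∈ , ks-ok) → AllP.map⁺ (All.map (zumkeller-coprimeMultiple b∈) ks-ok))
    valid))
  where
  valid : All (λ (b , ks) → b ∈ certifiedZumkeller × All (λ k → 0 < k × Coprime b k) ks) coprimeMultiples
  valid = toWitness {a? = all? (λ (b , ks) → b ∈? certifiedZumkeller ×-dec all? (λ k → 0 <? k ×-dec coprime? b k) ks)
                                coprimeMultiples} _

evenWindow : ∀ {t} → t < 968 → 2 ∣ 428 + t → Any (λ a → Family88 (428 + t ∸ a)) certifiedZumkeller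
evenWindow = toWitness
  {a? = allUpTo? (λ t → 2 ∣? 428 + t →-dec any? (λ a → family88? (428 + t ∸ a)) certifiedZumkeller) 968} _

oddWindow : ∀ {t} → t < 968 → ¬ 2 ∣ 94186 + t → Any (λ a → Family88 (94186 + t ∸ a)) oddSummands
oddWindow = toWitness
  {a? = allUpTo? (λ t → ¬? (2 ∣? 94186 + t) →-dec any? (λ a → family88? (94186 + t ∸ a)) oddSummands) 968} _

SumOfTwoIn : List ℕ → ℕ → Set
SumOfTwoIn zs n = Any (λ a → Any (λ b → a + b ≡ n) zs) zs

sumOfTwoIn? : ∀ zs n → Dec (SumOfTwoIn zs n)
sumOfTwoIn? zs n = any? (λ a → any? (λ b → a + b ≟ n) zs) zs

sumOfTwoZumkeller-from : {zs : List ℕ} → All Zumkeller zs → SumOfTwoIn zs n → SumOfTwoZumkeller n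
sumOfTwoZumkeller-from Zzs pair with find pair
... | a , a∈ , b∈ with find b∈
... | b , b∈ , a+b≡n = a , b , All.lookup Zzs a∈ , All.lookup Zzs b∈ , a+b≡n

evenBelow428 : ∀ {n} → n < 428 → 12 ≤ n → 2 ∣ n → n ∉ exceptions → SumOfTwoIn smallSummands n
evenBelow428 = toWitness {a? = allUpTo? (λ n → 12 ≤? n →-dec 2 ∣? n →-dec ¬? (n ∈? exceptions) →-dec
  sumOfTwoIn? smallSummands n) 428} _

NoSumBelow39 : ℕ → Set
NoSumBelow39 n = n < 39 × ¬ SumOfTwoIn zumkeller<39 n

noSumBelow39? : ∀ n → Dec (NoSumBelow39 n)
noSumBelow39? n = n <? 39 ×-dec ¬? (sumOfTwoIn? zumkeller<39 n)

noSumBelow39⇒¬sumOfTwoZumkeller : NoSumBelow39 n → ¬ SumOfTwoZumkeller n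
noSumBelow39⇒¬sumOfTwoZumkeller (n<39 , none) (a , b , Za , Zb , refl) =
  none (lose (∈-zumkeller<39 (≤-<-trans (m≤m+n a b) n<39) Za) (lose (∈-zumkeller<39 (≤-<-trans (m≤n+m b a) n<39) Zb) refl))

noSumBelow39 : ∀ n → {True (noSumBelow39? n)} → NoSumBelow39 n
noSumBelow39 n {ok} = toWitness ok

Admissible : ℕ → Set
Admissible n = n ≥ 12 × n ≢ 14 × n ≢ 16 × n ≢ 20 × n ≢ 22 × n ≢ 28 × n ≢ 38

sumOfTwoZumkeller⇒admissible : SumOfTwoZumkeller n → Admissible n
sumOfTwoZumkeller⇒admissible {n} n-as-sum =
  ≮⇒≥ (λ n<12 → excludes (below12 n<12) refl) , excludes (noSumBelow39 14) , excludes (noSumBelow39 16) ,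
  excludes (noSumBelow39 20) , excludes (noSumBelow39 22) , excludes (noSumBelow39 28) , excludes (noSumBelow39 38)
  where
  excludes : ∀ {e} → NoSumBelow39 e → n ≢ e
  excludes none refl = noSumBelow39⇒¬sumOfTwoZumkeller none n-as-sum
  below12 : ∀ {e} → e < 12 → NoSumBelow39 e
  below12 = toWitness {a? = allUpTo? noSumBelow39? 12} _

2∣q*968 : ∀ q → 2 ∣ q * 968
2∣q*968 q = ∣-trans (divides 484 refl) (n∣m*n q)

even∧admissible⇒sumOfTwoZumkeller : 2 ∣ n → Admissible n → SumOfTwoZumkeller n
even∧admissible⇒sumOfTwoZumkeller {n} 2∣n (12≤n , n≢14 , n≢16 , n≢20 , n≢22 , n≢28 , n≢38) with n <? 428
... | yes n<428 = sumOfTwoZumkeller-from smallSummands-zumkeller (evenBelow428 n<428 12≤n 2∣n n∉exceptions)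
  where
  smallSummands-zumkeller : All Zumkeller smallSummands
  smallSummands-zumkeller = All.map zumkeller-certified (toWitness {a? = all? (_∈? certifiedZumkeller) smallSummands} _)
  n∉exceptions : n ∉ exceptions
  n∉exceptions (here n≡14) = n≢14 n≡14
  n∉exceptions (there (here n≡16)) = n≢16 n≡16
  n∉exceptions (there (there (here n≡20))) = n≢20 n≡20
  n∉exceptions (there (there (there (here n≡22)))) = n≢22 n≡22
  n∉exceptions (there (there (there (there (here n≡28))))) = n≢28 n≡28
  n∉exceptions (there (there (there (there (there (here n≡38)))))) = n≢38 n≡38
... | no n≮428 = sumOfTwoZumkeller-window (2 ∣_)
  (λ m q 2∣m+q*968 → ∣m+n∣m⇒∣n (subst (2 ∣_) (+-comm m (q * 968)) 2∣m+q*968) (2∣q*968 q))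
  (All.tabulate zumkeller-certified) 428 evenWindow (≮⇒≥ n≮428) 2∣n

odd⇒sumOfTwoZumkeller : ¬ 2 ∣ n → n > 94185 → SumOfTwoZumkeller n
odd⇒sumOfTwoZumkeller 2∤n n>94185 = sumOfTwoZumkeller-window (λ m → ¬ 2 ∣ m)
  (λ m q 2∤m+q*968 2∣m → 2∤m+q*968 (∣m∣n⇒∣m+n 2∣m (2∣q*968 q)))
  oddSummands-zumkeller 94186 oddWindow n>94185 2∤n

proposition4p6 :
    ((n : ℕ) → 2 ∣ n →
      (SumOfTwoZumkeller n ⇔
        (n ≥ 12 × n ≢ 14 × n ≢ 16 × n ≢ 20 × n ≢ 22 × n ≢ 28 × n ≢ 38)))
    × ((n : ℕ) → ¬ (2 ∣ n) → n > 94185 → SumOfTwoZumkeller n)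
proposition4p6 =
  (λ n 2∣n → mk⇔ sumOfTwoZumkeller⇒admissible (even∧admissible⇒sumOfTwoZumkeller 2∣n)) ,
  (λ n → odd⇒sumOfTwoZumkeller)
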